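{- For any extensional partial K-model $E$, its completion $\overline E$ is hyperimmune iff $E$ is hyperimmune.
   Context: For a poset $E$, $\mathcal A_f(E)$ is the set of finite antichains ordered by $a\le b$ iff $\forall\alpha\in a\,\exists\beta\in b,\alpha\le\beta$, and $E\Rightarrow E:=\mathcal A_f(E)^{op}\times E$ (componentwise order). An extensional partial K-model is a pair $(E,j_E)$ with $E$ a poset and $j_E$ a partial function from $E\Rightarrow E$ to $E$ which is an order isomorphism between its domain $\mathrm{Dom}(j_E)$ (with the induced order) and $E$. Write $a\to\alpha:=j_E(a,\alpha)$; thus every $\alpha\in E$ is uniquely $a\to\alpha'$ with $(a,\alpha')\in\mathrm{Dom}(j_E)$, and iterating, uniquely $a_1\to\cdots\to a_n\to\alpha'$ for each $n$. Completion: $(E_0,j_{E_0})=(E,j_E)$; $|E_{n+1}|=|E_n|\cup(|E_n\Rightarrow E_n|\setminus\mathrm{Dom}(j_{E_n}))$; $j_{E_{n+1}}$ is defined on $|E_n\Rightarrow E_n|$ by $j_{E_{n+1}}=j_{E_n}\cup\mathrm{id}_{|E_n\Rightarrow E_n|\setminus\mathrm{Dom}(j_{E_n})}$; the order on $E_{n+1}$ is $j_{E_{n+1}}(a,\alpha)\le j_{E_{n+1}}(b,\beta)$ iff $a\ge b$ in $\mathcal A_f(E_n)$ and $\alpha\le\beta$ in $E_n$. The completion is $(\overline E,j_{\overline E})=(\bigcup_nE_n,\bigcup_nj_{E_n})$, an extensional K-model. A (possibly partial) extensional K-model $D$ is hyperimmune if there is no sequence $(\alpha_n)_{n\ge0}\in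 D^{\mathbb N}$ and recursive $g:\mathbb N\to\mathbb N$ such that for all $n$, writing $\alpha_n=a_{n,1}\to\cdots\to a_{n,g(n)}\to\alpha_n'$, one has $\alpha_{n+1}\in\bigcup_{k\le g(n)}a_{n,k}$. -}

module Defs where

open import Level using (0ℓ)
open import Data.Nat using (ℕ; zero; suc; _<_; _≤′_; ≤′-refl; ≤′-step)
open import Data.Fin using (Fin)
open import Data.Vec using (Vec; []; _∷_; lookup)
open import Data.List using (List; []; _∷_; map; _++_)
open import Data.List.Relation.Unary.All as All using (All)
open import Data.List.Relation.Unary.Any as Any using (Any)
open import Data.List.Relation.Unary.AllPairs as AllPairs using (AllPairs)
import Data.List.Relation.Unary.All.Properties as AllP
import Data.List.Relation.Unary.Any.Properties as AnyP
import Data.List.Relation.Unary.AllPairs.Properties as AllPairsP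
open import Data.Product using (Σ; ∃; _×_; _,_; proj₁; proj₂)
open import Relation.Nullary using (¬_)
open import Relation.Binary.Bundles using (Poset)

data Code : ℕ → Set where
  czero : ∀ {k} → Code k
  csucc : Code 1
  cproj : ∀ {k} → Fin k → Code k
  ccomp : ∀ {k m} → Code m → Vec (Code k) m → Code k
  cprec : ∀ {k} → Code k → Code (suc (suc k)) → Code (suc k)
  cmu   : ∀ {k} → Code (suc k) → Code k

mutual
  data Eval : ∀ {k} → Code k → Vec ℕ k → ℕ → Set where
    ezero  : ∀ {k} {xs : Vec ℕ k} → Eval czero xs 0
    esucc  : ∀ {x} → Eval csucc (x ∷ []) (suc x)
    eproj  : ∀ {k} (i : Fin k) (xs : Vec ℕ k) → Eval (cproj i) xs (lookup xs i)
    ecomp  : ∀ {k m} {f : Code m} {gs : Vec (Code k) m} {xs ys y} →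
             EvalAll gs xs ys → Eval f ys y → Eval (ccomp f gs) xs y
    eprec0 : ∀ {k} {f : Code k} {g xs y} →
             Eval f xs y → Eval (cprec f g) (0 ∷ xs) y
    eprecS : ∀ {k} {f : Code k} {g n xs r y} →
             Eval (cprec f g) (n ∷ xs) r → Eval g (n ∷ r ∷ xs) y →
             Eval (cprec f g) (suc n ∷ xs) y
    emu    : ∀ {k} {f : Code (suc k)} {xs n} →
             Eval f (n ∷ xs) 0 →
             (∀ m → m < n → ∃ λ v → Eval f (m ∷ xs) (suc v)) →
             Eval (cmu f) xs n

  data EvalAll {k} : ∀ {m} → Vec (Code k) m → Vec ℕ k → Vec ℕ m → Set where
    []  : ∀ {xs} → EvalAll [] xs []
    _∷_ : ∀ {m} {g} {gs : Vec (Code k) m} {xs y ys} →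
          Eval g xs y → EvalAll gs xs ys → EvalAll (g ∷ gs) xs (y ∷ ys)

IsRecursive : (ℕ → ℕ) → Set
IsRecursive g = Σ (Code 1) λ c → ∀ n → Eval c (n ∷ []) (g n)

record Ord : Set₁ where
  field
    Carrier : Set
    _≈_     : Carrier → Carrier → Set
    _≤_     : Carrier → Carrier → Set

PosetOrd : Poset 0ℓ 0ℓ 0ℓ → Ord
PosetOrd P = record { Carrier = Poset.Carrier P ; _≈_ = Poset._≈_ P ; _≤_ = Poset._≤_ P }

module _ (O : Ord) where
  open Ord O

  IsAntichain : List Carrier → Set
  IsAntichain = AllPairs (λ x y → ¬ (x ≤ y) × ¬ (y ≤ x))

  Antichain : Set
  Antichain = Σ (List Carrier) IsAntichain

  _≤A_ : List Carrier → List Carrier → Set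
  a ≤A b = All (λ α → Any (λ β → α ≤ β) b) a

  _≈A_ : List Carrier → List Carrier → Set
  a ≈A b = All (λ α → Any (λ β → α ≈ β) b) a × All (λ β → Any (λ α → β ≈ α) a) b

  -- E ⇒ E := A_f(E)^op × E with the componentwise order
  Arr : Ord
  Arr = record
    { Carrier = Antichain × Carrier
    ; _≈_ = λ p q → (proj₁ (proj₁ p) ≈A proj₁ (proj₁ q)) × (proj₂ p ≈ proj₂ q)
    ; _≤_ = λ p q → (proj₁ (proj₁ q) ≤A proj₁ (proj₁ p)) × (proj₂ p ≤ proj₂ q)
    }

record PartialKModel (P : Poset 0ℓ 0ℓ 0ℓ) : Set₁ where
  private
    E = PosetOrd P
  open Poset P using (Carrier; _≈_; _≤_)
  field
    Dom    : Ord.Carrier (Arr E) → Set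
    j      : (p : Ord.Carrier (Arr E)) → Dom p → Carrier
    j-mono : ∀ p q (dp : Dom p) (dq : Dom q) → Ord._≤_ (Arr E) p q → j p dp ≤ j q dq
    j-refl : ∀ p q (dp : Dom p) (dq : Dom q) → j p dp ≤ j q dq → Ord._≤_ (Arr E) p q
    j-surj : ∀ x → Σ (Ord.Carrier (Arr E)) λ p → Σ (Dom p) λ dp → j p dp ≈ x

-- Hyperimmunity, for a carrier D with equality ≈ and the decomposition
-- map  decode : α ↦ (a, α')  where α = a → α'  (i.e. the inverse of j)

module _ {D : Set} (_≈_ : D → D → Set) (decode : D → List D × D) where

  -- for α = a₁ → ⋯ → a_k → α' :  arrowsUpTo k α  lists  a₁ ∪ ⋯ ∪ a_k
  arrowsUpTo : ℕ → D → List D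
  arrowsUpTo zero    α = []
  arrowsUpTo (suc k) α = proj₁ (decode α) ++ arrowsUpTo k (proj₂ (decode α))

  HyperimmuneWrt : Set
  HyperimmuneWrt =
    ¬ (Σ (ℕ → D) λ α → Σ (ℕ → ℕ) λ g →
         IsRecursive g × (∀ n → Any (λ β → α (suc n) ≈ β) (arrowsUpTo (g n) (α n))))

module _ {P : Poset 0ℓ 0ℓ 0ℓ} (K : PartialKModel P) where
  open PartialKModel K
  open Poset P using (Carrier; _≈_; _≤_; module Eq) renaming (≤-respˡ-≈ to respˡ; ≤-respʳ-≈ to respʳ)

  decodeK : Carrier → List Carrier × Carrier
  decodeK x = proj₁ (proj₁ (proj₁ (j-surj x))) , proj₂ (proj₁ (j-surj x))

  Hyperimmune : Set
  Hyperimmune = HyperimmuneWrt _≈_ decodeK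

  -- E₀ = E, and E_{n+1} = E_n ∪ (E_n ⇒ E_n ∖ Dom j_{E_n})
  -- is represented through the bijection j_{E_{n+1}} : E_n ⇒ E_n → E_{n+1},
  -- i.e. the carrier of E_{n+1} is E_n ⇒ E_n (with j_{E_{n+1}} = id), and
  -- the inclusion E_n ⊆ E_{n+1} is ι n = j_{E_n}⁻¹ (suitably embedded).

  level : ℕ → Ord
  level zero    = PosetOrd P
  level (suc n) = Arr (level n)

  L : ℕ → Set
  L n = Ord.Carrier (level n)

  ι      : ∀ n → L n → L (suc n)
  ι-refl : ∀ n x y → Ord._≤_ (level (suc n)) (ι n x) (ι n y) → Ord._≤_ (level n) x y
  mapAC  : ∀ n {a} → IsAntichain (level n) a → IsAntichain (level (suc n)) (map (ι n) a)

  ι zero x = proj₁ (j-surj x)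
  ι (suc n) ((a , ac) , α) = (map (ι n) a , mapAC n ac) , ι n α

  mapAC n ac = AllPairsP.map⁺
    (AllPairs.map (λ {x} {y} h → (λ le → proj₁ h (ι-refl n x y le)) ,
                                  (λ le → proj₂ h (ι-refl n y x le))) ac)

  ι-refl zero x y h with j-surj x | j-surj y
  ... | p , dp , ex | q , dq , ey = respˡ ex (respʳ ey (j-mono p q dp dq h))
  ι-refl (suc n) ((a , _) , α) ((b , _) , β) (hA , hα) =
    All.map (λ {x} h → Any.map (λ {y} → ι-refl n x y) (AnyP.map⁻ h)) (AllP.map⁻ hA) ,
    ι-refl n α β hα

  -- the union  Ē = ⋃ₙ E_n  (as a colimit along the inclusions)
  Ē : Set
  Ē = Σ ℕ L

  liftTo : ∀ {n k} → n ≤′ k → L n → L k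
  liftTo ≤′-refl     x = x
  liftTo {k = suc k} (≤′-step p) x = ι k (liftTo p x)

  _≈̄_ : Ē → Ē → Set
  (n , x) ≈̄ (m , y) = Σ ℕ λ k → Σ (n ≤′ k) λ p → Σ (m ≤′ k) λ q →
                        Ord._≈_ (level k) (liftTo p x) (liftTo q y)

  -- decomposition in Ē, i.e. the inverse of j_Ē = ⋃ₙ j_{E_n}
  decodeĒ : Ē → List Ē × Ē
  decodeĒ (zero , x) with ι zero x
  ... | (a , _) , α = map (zero ,_) a , (zero , α)
  decodeĒ (suc n , ((a , _) , α)) = map (n ,_) a , (n , α)

  CompletionHyperimmune : Set
  CompletionHyperimmune = HyperimmuneWrt _≈̄_ decodeĒ

-- Every element of the completion lies in a finite stage E_n, and decomposing an element
-- of E_{n+1} as a → α' puts a and α' in E_n.  So along a sequence witnessing that the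
-- completion is not hyperimmune the stage strictly decreases until it reaches 0; from then
-- on the sequence lies in E, where j_Ē extends j_E, and the shifted bound g witnesses that
-- E is not hyperimmune.  Such a sequence only meets the arrows of its predecessor up to
-- equivalence, so it is first replaced by an equivalent sequence of actual members; this
-- needs decomposition to respect equivalence, which holds because two finite antichains
-- dominating each other have the same elements up to equivalence.
module Submission where

open import Defs
open import Level using (0ℓ)
open import Relation.Binary.Bundles using (Poset)
open import Function.Base using (_∘_)
open import Function.Bundles using (_⇔_; mk⇔)

open import Data.Nat using (ℕ; zero; suc; pred; z≤n; _+_; _∸_; _⊔_; _≤_; _≤′_; ≤′-refl; ≤′-step)
open import Data.Nat.Properties
  using (≤-refl; ≤-trans; ≤′-trans; ≤⇒≤′; ≤′⇒≤; m≤m⊔n; m≤n⊔m; m≤n+m; m≤n⇒m∸n≡0; n≤0⇒n≡0;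
         pred-mono-≤; pred[m∸n]≡m∸[1+n]; pred[n]≤n; +-comm; <-irrefl; module ≤-Reasoning)
open import Data.Fin using () renaming (zero to fzero)
open import Data.Vec using ([]; _∷_)
open import Data.List using (List; []; _∷_; map; _++_)
open import Data.List.Properties using (map-++; map-∘)
open import Data.List.Membership.Propositional using (_∈_; find; lose)
open import Data.List.Relation.Unary.All as All using (All; []; _∷_)
open import Data.List.Relation.Unary.Any as Any using (Any; here; there)
open import Data.List.Relation.Unary.AllPairs using (_∷_)
import Data.List.Relation.Unary.All.Properties as AllP
import Data.List.Relation.Unary.Any.Properties as AnyP
open import Data.Product using (Σ; _×_; _,_; proj₁; proj₂)
open import Data.Empty using (⊥-elim)
open import Relation.Binary.PropositionalEquality
  using (_≡_; refl; sym; cong; subst; subst₂; module ≡-Reasoning)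

≤′-irrelevant : ∀ {m n} (p q : m ≤′ n) → p ≡ q
≤′-irrelevant ≤′-refl     ≤′-refl     = refl
≤′-irrelevant ≤′-refl     (≤′-step q) = ⊥-elim (<-irrefl refl (≤′⇒≤ q))
≤′-irrelevant (≤′-step p) ≤′-refl     = ⊥-elim (<-irrefl refl (≤′⇒≤ p))
≤′-irrelevant (≤′-step p) (≤′-step q) = cong ≤′-step (≤′-irrelevant p q)

module _ {t : ℕ → ℕ} (descends : ∀ n → t (suc n) ≤ pred (t n)) where

  descent-bound : ∀ n → t n ≤ t 0 ∸ n
  descent-bound zero    = ≤-refl
  descent-bound (suc n) = begin
    t (suc n)         ≤⟨ descends n ⟩
    pred (t n)        ≤⟨ pred-mono-≤ (descent-bound n) ⟩
    pred (t 0 ∸ n)    ≡⟨ pred[m∸n]≡m∸[1+n] (t 0) n ⟩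
    t 0 ∸ suc n       ∎
    where open ≤-Reasoning

  descent-reaches-zero : ∀ i → t (i + t 0) ≡ 0
  descent-reaches-zero i =
    n≤0⇒n≡0 (subst (t (i + t 0) ≤_) (m≤n⇒m∸n≡0 (m≤n+m (t 0) i)) (descent-bound (i + t 0)))

plusCode : ℕ → Code 1
plusCode zero    = cproj fzero
plusCode (suc t) = ccomp csucc (plusCode t ∷ [])

eval-plusCode : ∀ t i → Eval (plusCode t) (i ∷ []) (t + i)
eval-plusCode zero    i = eproj fzero (i ∷ [])
eval-plusCode (suc t) i = ecomp (eval-plusCode t i ∷ []) esucc

IsRecursive-shift : ∀ t {g} → IsRecursive g → IsRecursive (λ i → g (t + i))
IsRecursive-shift t (c , eval-c) =
  ccomp c (plusCode t ∷ []) , λ i → ecomp (eval-plusCode t i ∷ []) (eval-c (t + i))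

IsRecursive-cong : ∀ {f g} → (∀ n → f n ≡ g n) → IsRecursive f → IsRecursive g
IsRecursive-cong f≗g (c , eval-c) = c , λ n → subst (Eval c (n ∷ [])) (f≗g n) (eval-c n)

NonHyperimmunityWitness : {D : Set} → (D → D → Set) → (D → List D × D) → Set
NonHyperimmunityWitness {D} _≈_ decode =
  Σ (ℕ → D) λ α → Σ (ℕ → ℕ) λ g →
    IsRecursive g × (∀ n → Any (λ β → α (suc n) ≈ β) (arrowsUpTo _≈_ decode (g n) (α n)))

module _ (O : Ord) where
  open Ord O using (Carrier) renaming (_≤_ to _⊑_)

  ≤A-refl : (∀ {x} → x ⊑ x) → ∀ {a} → _≤A_ O a a
  ≤A-refl ⊑-refl = All.tabulate (Any.map λ { refl → ⊑-refl })

  ≤A-trans : (∀ {x y z} → x ⊑ y → y ⊑ z → x ⊑ z) →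
             ∀ {a b c} → _≤A_ O a b → _≤A_ O b c → _≤A_ O a c
  ≤A-trans ⊑-trans a≤b b≤c = All.map below a≤b
    where
    below : ∀ {α} → Any (α ⊑_) _ → Any (α ⊑_) _
    below α⊑b with find α⊑b
    ... | β , β∈b , α⊑β = Any.map (⊑-trans α⊑β) (All.lookup b≤c β∈b)

  antichain-⊑-self : ∀ {b β} {Q : Carrier → Set} → IsAntichain O b → β ∈ b →
                     Any (λ γ → β ⊑ γ × Q γ) b → Q β
  antichain-⊑-self _            (here refl) (here (_ , q))   = q
  antichain-⊑-self (β⊥b ∷ _)    (here refl) (there β⊑b)      with find β⊑b
  ... | _ , γ∈b , β⊑γ , _ = ⊥-elim (proj₁ (All.lookup β⊥b γ∈b) β⊑γ)
  antichain-⊑-self (x⊥b ∷ _)    (there β∈b) (here (β⊑x , _)) = ⊥-elim (proj₂ (All.lookup x⊥b β∈b) β⊑x)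
  antichain-⊑-self (_ ∷ b-anti) (there β∈b) (there β⊑b)      = antichain-⊑-self b-anti β∈b β⊑b

  ≤A-antichain-equiv : (∀ {x y z} → x ⊑ y → y ⊑ z → x ⊑ z) → ∀ {a b} → IsAntichain O b →
                       _≤A_ O b a → _≤A_ O a b → All (λ β → Any (λ α → β ⊑ α × α ⊑ β) a) b
  ≤A-antichain-equiv ⊑-trans b-anti b≤a a≤b = All.tabulate equivalent
    where
    equivalent : ∀ {β} → β ∈ _ → Any (λ α → β ⊑ α × α ⊑ β) _
    equivalent β∈b with find (All.lookup b≤a β∈b)
    ... | α , α∈a , β⊑α = lose α∈a (β⊑α , antichain-⊑-self b-anti β∈b
                                             (Any.map (λ α⊑γ → ⊑-trans β⊑α α⊑γ , α⊑γ) (All.lookup a≤b α∈a)))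

module Completion {P : Poset 0ℓ 0ℓ 0ℓ} (K : PartialKModel P) where
  open PartialKModel K
  private module P = Poset P

  Leq : ∀ n → L K n → L K n → Set
  Leq n = Ord._≤_ (level K n)
  syntax Leq n x y = x ≤[ n ] y

  Equiv : ∀ n → L K n → L K n → Set
  Equiv n x y = x ≤[ n ] y × y ≤[ n ] x
  syntax Equiv n x y = x ≃[ n ] y

  ≤[]-refl : ∀ n {x} → x ≤[ n ] x
  ≤[]-refl zero    = P.refl
  ≤[]-refl (suc n) = ≤A-refl (level K n) (≤[]-refl n) , ≤[]-refl n

  ≤[]-trans : ∀ n {x y z} → x ≤[ n ] y → y ≤[ n ] z → x ≤[ n ] z
  ≤[]-trans zero = P.trans
  ≤[]-trans (suc n) (b≤a , α≤β) (c≤b , β≤γ) =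
    ≤A-trans (level K n) (≤[]-trans n) c≤b b≤a , ≤[]-trans n α≤β β≤γ

  ≃[]-refl : ∀ n {x} → x ≃[ n ] x
  ≃[]-refl n = ≤[]-refl n , ≤[]-refl n

  ≃[]-trans : ∀ n {x y z} → x ≃[ n ] y → y ≃[ n ] z → x ≃[ n ] z
  ≃[]-trans n (x≤y , y≤x) (y≤z , z≤y) = ≤[]-trans n x≤y y≤z , ≤[]-trans n z≤y y≤x

  ≈[]⇒≃[] : ∀ n {x y} → Ord._≈_ (level K n) x y → x ≃[ n ] y
  ≈[]⇒≃[] zero    x≈y = P.reflexive x≈y , P.reflexive (P.Eq.sym x≈y)
  ≈[]⇒≃[] (suc n) ((a≈b , b≈a) , α≈β) =
    (weaken b≈a , proj₁ (≈[]⇒≃[] n α≈β)) , (weaken a≈b , proj₂ (≈[]⇒≃[] n α≈β))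
    where
    weaken : ∀ {a b} → All (λ x → Any (Ord._≈_ (level K n) x) b) a → _≤A_ (level K n) a b
    weaken = All.map (Any.map (proj₁ ∘ ≈[]⇒≃[] n))

  ι-mono : ∀ n {x y} → x ≤[ n ] y → ι K n x ≤[ suc n ] ι K n y
  ι-mono zero {x} {y} x≤y with j-surj x | j-surj y
  ... | p , dp , jp≈x | q , dq , jq≈y =
    j-refl p q dp dq (P.≤-respˡ-≈ (P.Eq.sym jp≈x) (P.≤-respʳ-≈ (P.Eq.sym jq≈y) x≤y))
  ι-mono (suc n) (b≤a , α≤β) =
    AllP.map⁺ (All.map (λ β≤a → AnyP.map⁺ (Any.map (ι-mono n) β≤a)) b≤a) , ι-mono n α≤β

  ι-≃ : ∀ n {x y} → x ≃[ n ] y → ι K n x ≃[ suc n ] ι K n y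
  ι-≃ n (x≤y , y≤x) = ι-mono n x≤y , ι-mono n y≤x

  liftTo-≃ : ∀ {m k} (p : m ≤′ k) {x y} → x ≃[ m ] y → liftTo K p x ≃[ k ] liftTo K p y
  liftTo-≃ ≤′-refl         x≃y = x≃y
  liftTo-≃ (≤′-step {k} p) x≃y = ι-≃ k (liftTo-≃ p x≃y)

  liftTo-∘ : ∀ {m k n} (p : m ≤′ k) (q : k ≤′ n) (r : m ≤′ n) x →
             liftTo K q (liftTo K p x) ≡ liftTo K r x
  liftTo-∘ p ≤′-refl          r           x = cong (λ r → liftTo K r x) (≤′-irrelevant p r)
  liftTo-∘ p (≤′-step {k} q) (≤′-step r) x = cong (ι K k) (liftTo-∘ p q r x)
  liftTo-∘ p (≤′-step q)     ≤′-refl     x = ⊥-elim (<-irrefl refl (≤′⇒≤ (≤′-trans p q)))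

  record _≃_ (c d : Ē K) : Set where
    constructor ≃-via
    field
      {stage} : ℕ
      c↑      : proj₁ c ≤′ stage
      d↑      : proj₁ d ≤′ stage
      agree   : liftTo K c↑ (proj₂ c) ≃[ stage ] liftTo K d↑ (proj₂ d)

  ≃-stage : ∀ {n x y} → x ≃[ n ] y → (n , x) ≃ (n , y)
  ≃-stage = ≃-via ≤′-refl ≤′-refl

  ≃-refl : ∀ {c} → c ≃ c
  ≃-refl {n , _} = ≃-stage (≃[]-refl n)

  ≃-sym : ∀ {c d} → c ≃ d → d ≃ c
  ≃-sym (≃-via c↑ d↑ (c≤d , d≤c)) = ≃-via d↑ c↑ (d≤c , c≤d)

  ≃-trans : ∀ {c d e} → c ≃ d → d ≃ e → c ≃ e
  ≃-trans {_ , x} {_ , y} {_ , z} (≃-via {k} p q x≃y) (≃-via {k′} q′ r y≃z) =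
    ≃-via (≤′-trans p s) (≤′-trans r s′) (≃[]-trans (k ⊔ k′) x≃y↑ y≃z↑)
    where
    s : k ≤′ k ⊔ k′
    s = ≤⇒≤′ (m≤m⊔n k k′)
    s′ : k′ ≤′ k ⊔ k′
    s′ = ≤⇒≤′ (m≤n⊔m k k′)
    x≃y↑ : liftTo K (≤′-trans p s) x ≃[ k ⊔ k′ ] liftTo K (≤′-trans q′ s′) y
    x≃y↑ = subst₂ (Equiv (k ⊔ k′)) (liftTo-∘ p s (≤′-trans p s) x) (liftTo-∘ q s (≤′-trans q′ s′) y)
                  (liftTo-≃ s x≃y)
    y≃z↑ : liftTo K (≤′-trans q′ s′) y ≃[ k ⊔ k′ ] liftTo K (≤′-trans r s′) z
    y≃z↑ = subst₂ (Equiv (k ⊔ k′)) (liftTo-∘ q′ s′ (≤′-trans q′ s′) y) (liftTo-∘ r s′ (≤′-trans r s′) z)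
                  (liftTo-≃ s′ y≃z)

  ≈̄⇒≃ : ∀ {c d} → _≈̄_ K c d → c ≃ d
  ≈̄⇒≃ (k , c↑ , d↑ , c≈d) = ≃-via c↑ d↑ (≈[]⇒≃[] k c≈d)

  ≃-liftTo : ∀ {m k} (p : m ≤′ k) x → (m , x) ≃ (k , liftTo K p x)
  ≃-liftTo {k = k} p x = ≃-via p ≤′-refl (≃[]-refl k)

  Covers : List (Ē K) → List (Ē K) → Set
  Covers xs ys = All (λ y → Any (_≃ y) xs) ys

  Covers-refl : ∀ xs → Covers xs xs
  Covers-refl xs = All.tabulate (Any.map λ { refl → ≃-refl })

  Covers-trans : ∀ {xs ys zs} → Covers xs ys → Covers ys zs → Covers xs zs
  Covers-trans xs⊒ys ys⊒zs = All.map through ys⊒zs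
    where
    through : ∀ {z} → Any (_≃ z) _ → Any (_≃ z) _
    through y≃z with find y≃z
    ... | y , y∈ys , y≃z = Any.map (λ x≃y → ≃-trans x≃y y≃z) (All.lookup xs⊒ys y∈ys)

  Covers-++ : ∀ {xs ys xs′ ys′} → Covers xs ys → Covers xs′ ys′ → Covers (xs ++ xs′) (ys ++ ys′)
  Covers-++ {xs} xs⊒ys xs′⊒ys′ = AllP.++⁺ (All.map AnyP.++⁺ˡ xs⊒ys) (All.map (AnyP.++⁺ʳ xs) xs′⊒ys′)

  Covers-map : ∀ {A : Set} {f g : A → Ē K} → (∀ y → f y ≃ g y) → ∀ a → Covers (map f a) (map g a)
  Covers-map f≃g []      = []
  Covers-map f≃g (y ∷ a) = here (f≃g y) ∷ All.map there (Covers-map f≃g a)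

  record DecodeCovers (c d : Ē K) : Set where
    constructor _,_
    field
      arguments : Covers (proj₁ (decodeĒ K c)) (proj₁ (decodeĒ K d))
      result    : proj₂ (decodeĒ K c) ≃ proj₂ (decodeĒ K d)

  DecodeCovers-refl : ∀ {c} → DecodeCovers c c
  DecodeCovers-refl = Covers-refl _ , ≃-refl

  DecodeCovers-trans : ∀ {c d e} → DecodeCovers c d → DecodeCovers d e → DecodeCovers c e
  DecodeCovers-trans (as , r) (as′ , r′) = Covers-trans as as′ , ≃-trans r r′

  -- Stage 0 is decoded through ι K 0 = j⁻¹, so (0 , x) and (1 , ι K 0 x) have the same decoding.
  DecodeCovers-stage : ∀ n {x y} → x ≃[ n ] y → DecodeCovers (n , x) (n , y)
  DecodeCovers-stage zero {x} {y} x≃y with DecodeCovers-stage 1 {ι K 0 x} {ι K 0 y} (ι-≃ 0 x≃y)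
  ... | arguments , result = arguments , result
  DecodeCovers-stage (suc n) {(a , _) , α} {(b , b-anti) , β} ((b≤a , α≤β) , (a≤b , β≤α)) =
    AllP.map⁺ (All.map (AnyP.map⁺ ∘ Any.map (λ (β≤α′ , α′≤β) → ≃-stage (α′≤β , β≤α′)))
                       (≤A-antichain-equiv (level K n) (≤[]-trans n) b-anti b≤a a≤b)) ,
    ≃-stage (α≤β , β≤α)

  ≃-ι : ∀ m y → (m , y) ≃ (suc m , ι K m y)
  ≃-ι m = ≃-liftTo (≤′-step ≤′-refl)

  DecodeCovers-ι : ∀ m x → DecodeCovers (m , x) (suc m , ι K m x) × DecodeCovers (suc m , ι K m x) (m , x)
  DecodeCovers-ι zero    x = (Covers-refl _ , ≃-refl) , (Covers-refl _ , ≃-refl)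
  DecodeCovers-ι (suc m) ((a , _) , α) =
    (subst (Covers _) (map-∘ a) (Covers-map (≃-ι m) a) , ≃-ι m α) ,
    (subst (λ xs → Covers xs (map (m ,_) a)) (map-∘ a) (Covers-map (≃-sym ∘ ≃-ι m) a) , ≃-sym (≃-ι m α))

  DecodeCovers-liftTo : ∀ {m k} (p : m ≤′ k) x →
                        DecodeCovers (m , x) (k , liftTo K p x) × DecodeCovers (k , liftTo K p x) (m , x)
  DecodeCovers-liftTo ≤′-refl         x = DecodeCovers-refl , DecodeCovers-refl
  DecodeCovers-liftTo (≤′-step {k} p) x with DecodeCovers-liftTo p x | DecodeCovers-ι k (liftTo K p x)
  ... | up , down | up′ , down′ = DecodeCovers-trans up up′ , DecodeCovers-trans down′ down

  DecodeCovers-≃ : ∀ {c d} → c ≃ d → DecodeCovers c d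
  DecodeCovers-≃ {_ , x} {_ , y} (≃-via {k} p q x≃y) =
    DecodeCovers-trans (proj₁ (DecodeCovers-liftTo p x))
      (DecodeCovers-trans (DecodeCovers-stage k x≃y) (proj₂ (DecodeCovers-liftTo q y)))

  arrows : ℕ → Ē K → List (Ē K)
  arrows = arrowsUpTo (_≈̄_ K) (decodeĒ K)

  arrows-Covers : ∀ k {c d} → c ≃ d → Covers (arrows k c) (arrows k d)
  arrows-Covers zero    c≃d = []
  arrows-Covers (suc k) c≃d with DecodeCovers-≃ c≃d
  ... | arguments , result = Covers-++ arguments (arrows-Covers k result)

  rank : Ē K → ℕ
  rank = proj₁

  decodeĒ-rank : ∀ c → All (λ y → rank y ≤ pred (rank c)) (proj₁ (decodeĒ K c)) ×
                       rank (proj₂ (decodeĒ K c)) ≤ pred (rank c)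
  decodeĒ-rank (zero , _)              = AllP.map⁺ (All.universal (λ _ → z≤n) _) , z≤n
  decodeĒ-rank (suc n , ((a , _) , _)) = AllP.map⁺ (All.universal (λ _ → ≤-refl) a) , ≤-refl

  arrows-rank : ∀ k c → All (λ y → rank y ≤ pred (rank c)) (arrows k c)
  arrows-rank zero    c = []
  arrows-rank (suc k) c with decodeĒ-rank c
  ... | arguments-rank , result-rank =
    AllP.++⁺ arguments-rank
      (All.map (λ y-rank → ≤-trans y-rank (≤-trans pred[n]≤n result-rank)) (arrows-rank k _))

  groundArrows : ℕ → L K 0 → List (L K 0)
  groundArrows = arrowsUpTo (Poset._≈_ P) (decodeK K)

  arrows-ground : ∀ k x → arrows k (zero , x) ≡ map (zero ,_) (groundArrows k x)
  arrows-ground zero    x = refl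
  arrows-ground (suc k) x = begin
    map (zero ,_) a ++ arrows k (zero , α)              ≡⟨ cong (map (zero ,_) a ++_) (arrows-ground k α) ⟩
    map (zero ,_) a ++ map (zero ,_) (groundArrows k α) ≡⟨ map-++ (zero ,_) a (groundArrows k α) ⟨
    map (zero ,_) (a ++ groundArrows k α)               ∎
    where
    open ≡-Reasoning
    a = proj₁ (decodeK K x)
    α = proj₂ (decodeK K x)

  atGround : (c : Ē K) → rank c ≡ 0 → L K 0
  atGround (zero , x) refl = x

  arrows-atGround : ∀ {c c′} (c₀ : rank c ≡ 0) (c′₀ : rank c′ ≡ 0) k → c′ ∈ arrows k c →
                    Any (P._≈_ (atGround c′ c′₀)) (groundArrows k (atGround c c₀))
  arrows-atGround {zero , x} {zero , _} refl refl k c′∈ rewrite arrows-ground k x =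
    Any.map (λ { refl → P.Eq.refl }) (AnyP.map⁻ c′∈)

  module Representatives (α : ℕ → Ē K) (g : ℕ → ℕ)
                         (hits : ∀ n → Any (_≈̄_ K (α (suc n))) (arrows (g n) (α n))) where

    next : ∀ n {c} → c ≃ α n → Σ (Ē K) λ c′ → c′ ≃ α (suc n) × c′ ∈ arrows (g n) c
    next n c≃αn with find (hits n)
    ... | β , β∈ , αsn≈β with find (All.lookup (arrows-Covers (g n) c≃αn) β∈)
    ...   | c′ , c′∈ , c′≃β = c′ , ≃-trans c′≃β (≃-sym (≈̄⇒≃ αsn≈β)) , c′∈

    representative : ∀ n → Σ (Ē K) (_≃ α n)
    representative zero    = α 0 , ≃-refl
    representative (suc n) = proj₁ step , proj₁ (proj₂ step)
      where step = next n (proj₂ (representative n))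

    c : ℕ → Ē K
    c n = proj₁ (representative n)

    c-step : ∀ n → c (suc n) ∈ arrows (g n) (c n)
    c-step n = proj₂ (proj₂ (next n (proj₂ (representative n))))

  GroundWitness : Set
  GroundWitness = NonHyperimmunityWitness (Poset._≈_ P) (decodeK K)

  CompletionWitness : Set
  CompletionWitness = NonHyperimmunityWitness (_≈̄_ K) (decodeĒ K)

  ground⇒completion-witness : GroundWitness → CompletionWitness
  ground⇒completion-witness (α , g , g-rec , hits) = (λ n → zero , α n) , g , g-rec , hits′
    where
    hits′ : ∀ n → Any (_≈̄_ K (zero , α (suc n))) (arrows (g n) (zero , α n))
    hits′ n = subst (Any (_≈̄_ K (zero , α (suc n)))) (sym (arrows-ground (g n) (α n)))
                    (AnyP.map⁺ (Any.map (λ e → zero , ≤′-refl , ≤′-refl , e) (hits n)))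

  completion⇒ground-witness : CompletionWitness → GroundWitness
  completion⇒ground-witness (α , g , g-rec , hits) = x , g′ , g′-rec , x-step
    where
    open Representatives α g hits
    t : ℕ → ℕ
    t = rank ∘ c
    grounded : ∀ i → rank (c (i + t 0)) ≡ 0
    grounded = descent-reaches-zero {t} λ n → All.lookup (arrows-rank (g n) (c n)) (c-step n)
    x : ℕ → L K 0
    x i = atGround (c (i + t 0)) (grounded i)
    g′ : ℕ → ℕ
    g′ i = g (i + t 0)
    g′-rec : IsRecursive g′
    g′-rec = IsRecursive-cong (λ i → cong g (+-comm (t 0) i)) (IsRecursive-shift (t 0) g-rec)
    x-step : ∀ i → Any (P._≈_ (x (suc i))) (groundArrows (g′ i) (x i))
    x-step i = arrows-atGround (grounded i) (grounded (suc i)) (g′ i) (c-step (i + t 0))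

mainTheorem13 : (P : Poset 0ℓ 0ℓ 0ℓ) (K : PartialKModel P) →
                CompletionHyperimmune K ⇔ Hyperimmune K
mainTheorem13 P K = mk⇔ (λ hyp → hyp ∘ ground⇒completion-witness)
                        (λ hyp → hyp ∘ completion⇒ground-witness)
  where open Completion K
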